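{- Let $n\geq 1$, let $U_{6n}=\langle a,b\mid a^{2n}=b^3=1,\ a^{ -1}ba=b^{ -1}\rangle$, and let $\Gamma=\Gamma(U_{6n})$ be its non-commuting graph. Then the detour index of $\Gamma$ is $dd(\Gamma)=\frac{5n(5n-1)^2}{2}$.
   Context: The group $U_{6n}$ has order $6n$ and center $Z(U_{6n})=\langle a^2\rangle$. For a finite group $G$, the non-commuting graph $\Gamma(G)$ has vertex set $G\setminus Z(G)$, and two distinct vertices $x,y$ are adjacent iff $xy\neq yx$. The detour distance $D(u,v)$ is the length of a longest simple path from $u$ to $v$; the detour index polynomial is $D(\Gamma,x)=\sum_{\{u,v\}}x^{D(u,v)}$ over unordered pairs of distinct vertices, and the detour index $dd(\Gamma)$ is the derivative of $D(\Gamma,x)$ evaluated at $x=1$. -}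

module Defs where

open import Data.Nat using (ℕ; zero; suc; _+_; _*_; _∸_; _^_; _≤_; _%_; _≡ᵇ_; NonZero)
open import Data.Nat.Properties using (m*n≢0)
open import Data.Nat.DivMod using (_mod_)
open import Data.Fin using (Fin; toℕ)
open import Data.Fin.Properties using (all?)
import Data.Fin.Properties as FinP
open import Data.Product using (_×_; _,_; ∃; proj₁; proj₂)
open import Data.Product.Properties using (≡-dec)
open import Data.Bool using (if_then_else_)
open import Data.List using (List; []; _∷_; length; filter; cartesianProduct; map; allFin)
open import Data.Nat.ListAction using (sum)
open import Data.List.Relation.Unary.Unique.Propositional using (Unique)
open import Relation.Binary.PropositionalEquality using (_≡_; _≢_)
open import Relation.Nullary using (¬_; Dec; yes; no; ¬?; does)
open import Relation.Nullary.Decidable using (map′)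

-- The group U_{6n} = < a, b | a^{2n} = b^3 = 1, a^{-1} b a = b^{-1} >,
-- realised on its normal forms a^i b^j (0 ≤ i < 2n, 0 ≤ j < 3).
-- From a^{-1} b a = b^{-1} we get b^j a^k = a^k b^{(-1)^k j}, hence
--   (a^i b^j)(a^k b^l) = a^{i+k} b^{(-1)^k j + l}.
module U (n : ℕ) .{{nz : NonZero n}} where

  instance
    nz2 : NonZero (2 * n)
    nz2 = m*n≢0 2 n

  G : Set
  G = Fin (2 * n) × Fin 3

  -- (-1)^k j  mod 3
  twist : Fin (2 * n) → Fin 3 → ℕ
  twist k j = if (toℕ k % 2 ≡ᵇ 0) then toℕ j else 3 ∸ toℕ j

  _·_ : G → G → G
  (i , j) · (k , l) = ((toℕ i + toℕ k) mod (2 * n)) , ((twist k j + toℕ l) mod 3)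

  infixl 7 _·_

  _≟G_ : (x y : G) → Dec (x ≡ y)
  _≟G_ = ≡-dec FinP._≟_ FinP._≟_

  Central : G → Set
  Central z = ∀ g → z · g ≡ g · z

  central? : (z : G) → Dec (Central z)
  central? z = map′ (λ h (i , j) → h i j) (λ h i j → h (i , j))
                    (all? (λ i → all? (λ j → (z · (i , j)) ≟G ((i , j) · z))))

  Vertex : G → Set
  Vertex x = ¬ Central x

  Adj : G → G → Set
  Adj x y = Vertex x × Vertex y × x ≢ y × (x · y ≢ y · x)

  data Walk : G → List G → G → Set where
    stop : ∀ {u} → Vertex u → Walk u (u ∷ []) u
    step : ∀ {u w v ps} → Adj u w → Walk w ps v → Walk u (u ∷ ps) v

  -- A simple path from u to v (no repeated vertex); its length is (#vertices − 1)
  SimplePath : G → List G → G → Set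
  SimplePath u ps v = Walk u ps v × Unique ps

  IsDetourDistance : G → G → ℕ → Set
  IsDetourDistance u v d =
    (∃ λ ps → SimplePath u ps v × length ps ≡ suc d) ×
    (∀ ps → SimplePath u ps v → length ps ≤ suc d)

  elements : List G
  elements = cartesianProduct (allFin (2 * n)) (allFin 3)

  vertices : List G
  vertices = filter (λ x → ¬? (central? x)) elements

  -- Sum of D(u,v) over ORDERED pairs of distinct vertices ( = 2 · dd(Γ) )
  orderedDetourSum : (G → G → ℕ) → ℕ
  orderedDetourSum D =
    sum (map (λ u → sum (map (λ v → if does (u ≟G v) then 0 else D u v) vertices)) vertices)

-- Writing elements as a^i b^j (i < 2n, j < 3), whether two of them commute depends only on
-- their kinds: central (i even, j = 0), even (i even, j ≠ 0) and odd j (i odd). Even and odd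
-- elements never commute, two odd ones commute iff they have the same j, and everything else
-- commutes. So Γ is complete multipartite on 5n vertices with parts of sizes 2n, n, n, n, and
-- any two distinct vertices are joined by a Hamiltonian path: one path per pair of kinds is
-- written down using chains a^(2m)b, a^(2m+1), a^(2m)b², a^(2m+1)b, a^(2m+1)b² for the
-- remaining m, and transpositions of vertices of equal kind, which are automorphisms of Γ,
-- move its ends onto the given vertices. Hence every detour distance is 5n − 1.

module Submission where

open import Defs
open import Data.Nat
open import Data.Nat.Properties
open import Algebra.Properties.CommutativeSemigroup +-commutativeSemigroup using (x∙yz≈y∙xz)
open import Data.Nat.DivMod using (_mod_; [m+kn]%n≡m%n)
open import Data.Fin as Fin using (Fin; toℕ; fromℕ<)
open import Data.Fin.Patterns using (0F; 1F; 2F)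
import Data.Fin.Properties as Fin
open import Data.Bool using (Bool; true; false; if_then_else_; not; T)
import Data.Bool.Properties as Bool
open import Data.Product using (Σ; _×_; _,_; proj₁; proj₂)
open import Data.Product.Properties using (≡-dec)
open import Data.Sum using (inj₁; inj₂)
open import Data.Empty using (⊥-elim)
open import Function using (_∘_; id)
open import Relation.Unary using (Pred; Decidable)
open import Relation.Nullary using (¬_; ¬?; Dec; does; yes; no)
open import Relation.Nullary.Decidable using (True; T?; from-yes; toWitness; decidable-stable; dec-true; dec-false)
open import Relation.Binary.Definitions using (DecidableEquality)
open import Relation.Binary.PropositionalEquality
open import Data.List using (List; []; _∷_; _++_; map; length; tabulate; filter; cartesianProduct; allFin; take; drop)
open import Data.Nat.ListAction using (sum)
open import Data.Nat.ListAction.Properties using (sum-++)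
import Data.List.Properties as List
open import Data.List.Relation.Unary.All as All using (All; []; _∷_)
import Data.List.Relation.Unary.All.Properties as All
open import Data.List.Relation.Unary.Any using (here; there)
open import Data.List.Relation.Unary.Unique.Propositional using (Unique)
open import Data.List.Relation.Unary.AllPairs using ([]; _∷_)
import Data.List.Relation.Unary.Unique.Propositional.Properties as Unique
open import Data.List.Relation.Binary.Disjoint.Propositional using (Disjoint)
open import Data.List.Relation.Binary.Subset.Propositional using (_⊆_)
open import Data.List.Membership.Propositional using (_∈_; _∉_)
import Data.List.Relation.Unary.Unique.DecPropositional as DecUnique
import Data.List.Membership.DecPropositional as DecMembership
open import Data.List.Membership.Propositional.Properties
  using (∈-++⁻; ∈-++⁺ˡ; ∈-++⁺ʳ; ∈-∃++; ∈-filter⁺; ∈-cartesianProduct⁺; ∈-cartesianProduct⁻; ∈-allFin)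

module _ {A : Set} where

  Unique-insert : ∀ xs {ys zs : List A} → Unique (xs ++ zs) → Unique ys →
                  Disjoint ys (xs ++ zs) → Unique (xs ++ ys ++ zs)
  Unique-insert []       !xzs       !ys ys#xzs = Unique.++⁺ !ys !xzs ys#xzs
  Unique-insert (x ∷ xs) {ys} (x∉ ∷ !xzs) !ys ys#xzs =
    All.tabulate x≢ ∷ Unique-insert xs !xzs !ys (λ (p , q) → ys#xzs (p , there q))
    where
    x≢ : ∀ {y} → y ∈ xs ++ ys ++ _ → x ≢ y
    x≢ y∈ refl with ∈-++⁻ xs y∈
    ... | inj₁ p = All.lookup x∉ (∈-++⁺ˡ p) refl
    ... | inj₂ q with ∈-++⁻ ys q
    ...   | inj₁ r = ys#xzs (r , here refl)
    ...   | inj₂ r = All.lookup x∉ (∈-++⁺ʳ xs r) refl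

  Unique-++⇒Disjoint : ∀ xs {ys : List A} → Unique (xs ++ ys) → Disjoint xs ys
  Unique-++⇒Disjoint (x ∷ xs) (x∉ ∷ _) (here refl , v∈ys) = All.lookup x∉ (∈-++⁺ʳ xs v∈ys) refl
  Unique-++⇒Disjoint (x ∷ xs) (_ ∷ !xs) (there v∈xs , v∈ys) = Unique-++⇒Disjoint xs !xs (v∈xs , v∈ys)

  length-insert : ∀ (xs ys zs : List A) → length (xs ++ ys ++ zs) ≡ length ys + length (xs ++ zs)
  length-insert xs ys zs = begin
    length (xs ++ ys ++ zs)               ≡⟨ List.length-++ xs ⟩
    length xs + length (ys ++ zs)         ≡⟨ cong (length xs +_) (List.length-++ ys) ⟩
    length xs + (length ys + length zs)   ≡⟨ x∙yz≈y∙xz (length xs) (length ys) (length zs) ⟩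
    length ys + (length xs + length zs)   ≡⟨ cong (length ys +_) (List.length-++ xs) ⟨
    length ys + length (xs ++ zs)         ∎
    where open ≡-Reasoning

  Unique-⊆⇒length≤ : ∀ {xs ys : List A} → Unique xs → xs ⊆ ys → length xs ≤ length ys
  Unique-⊆⇒length≤ {[]}     _          _  = z≤n
  Unique-⊆⇒length≤ {x ∷ xs} (x∉ ∷ !xs) xs⊆ys with ∈-∃++ (xs⊆ys (here refl))
  ... | ys₁ , ys₂ , refl = begin
    suc (length xs)                  ≤⟨ s≤s (Unique-⊆⇒length≤ !xs xs⊆ys₁₂) ⟩
    suc (length (ys₁ ++ ys₂))        ≡⟨ cong suc (List.length-++ ys₁) ⟩
    suc (length ys₁ + length ys₂)    ≡⟨ sym (+-suc (length ys₁) _) ⟩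
    length ys₁ + length (x ∷ ys₂)    ≡⟨ sym (List.length-++ ys₁) ⟩
    length (ys₁ ++ x ∷ ys₂)          ∎
    where
    open ≤-Reasoning
    xs⊆ys₁₂ : xs ⊆ ys₁ ++ ys₂
    xs⊆ys₁₂ {y} y∈xs with ∈-++⁻ ys₁ (xs⊆ys (there y∈xs))
    ... | inj₁ p         = ∈-++⁺ˡ p
    ... | inj₂ (here eq) = ⊥-elim (All.lookup x∉ y∈xs (sym eq))
    ... | inj₂ (there p) = ∈-++⁺ʳ ys₁ p

  sum-map-const : ∀ (f : A → ℕ) c (xs : List A) → (∀ {x} → x ∈ xs → f x ≡ c) →
                  sum (map f xs) ≡ length xs * c
  sum-map-const f c []       _  = refl
  sum-map-const f c (x ∷ xs) fc = cong₂ _+_ (fc (here refl)) (sum-map-const f c xs (fc ∘ there))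

length-allFin : ∀ n → length (allFin n) ≡ n
length-allFin n = List.length-tabulate {n = n} id

module _ {A : Set} (_≟_ : DecidableEquality A) (c : ℕ) where

  sumOverOthers : A → List A → ℕ
  sumOverOthers u = sum ∘ map (λ v → if does (u ≟ v) then 0 else c)

  sumOverOthers-∉ : ∀ {u} xs → u ∉ xs → sumOverOthers u xs ≡ length xs * c
  sumOverOthers-∉ {u} xs u∉xs = sum-map-const _ c xs λ {v} v∈xs →
    cong (λ b → if b then 0 else c) (dec-false (u ≟ v) λ { refl → u∉xs v∈xs })

  sumOverOthers-∈ : ∀ {u xs} → Unique xs → u ∈ xs → c + sumOverOthers u xs ≡ length xs * c
  sumOverOthers-∈ {u} {x ∷ xs} (x∉ ∷ _) (here refl)
    rewrite dec-true (u ≟ u) refl = cong (c +_) (sumOverOthers-∉ xs λ u∈xs → All.lookup x∉ u∈xs refl)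
  sumOverOthers-∈ {u} {x ∷ xs} (x∉ ∷ !xs) (there u∈xs)
    rewrite dec-false (u ≟ x) (λ u≡x → All.lookup x∉ u∈xs (sym u≡x)) = cong (c +_) (sumOverOthers-∈ !xs u∈xs)

  sumOverDistinctPairs : ∀ {xs} → Unique xs →
    sum (map (λ u → sumOverOthers u xs) xs) ≡ length xs * ((length xs ∸ 1) * c)
  sumOverDistinctPairs {[]}     _   = refl
  sumOverDistinctPairs {x ∷ xs} !xs = sum-map-const _ _ (x ∷ xs) λ u∈xs →
    +-cancelˡ-≡ c _ _ (sumOverOthers-∈ !xs u∈xs)

module _ {A : Set} {p} {P : Pred A p} (P? : Decidable P) where

  length-filter≡sum : ∀ xs → length (filter P? xs) ≡ sum (map (λ x → if does (P? x) then 1 else 0) xs)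
  length-filter≡sum []       = refl
  length-filter≡sum (x ∷ xs) with does (P? x)
  ... | true  = cong suc (length-filter≡sum xs)
  ... | false = length-filter≡sum xs

sum-cartesianProduct : ∀ {A B : Set} (f : A × B → ℕ) xs ys →
  sum (map f (cartesianProduct xs ys)) ≡ sum (map (λ x → sum (map (λ y → f (x , y)) ys)) xs)
sum-cartesianProduct f []       ys = refl
sum-cartesianProduct f (x ∷ xs) ys = begin
  sum (map f (map (x ,_) ys ++ cartesianProduct xs ys))
    ≡⟨ cong sum (List.map-++ f (map (x ,_) ys) _) ⟩
  sum (map f (map (x ,_) ys) ++ map f (cartesianProduct xs ys))
    ≡⟨ sum-++ (map f (map (x ,_) ys)) _ ⟩
  sum (map f (map (x ,_) ys)) + sum (map f (cartesianProduct xs ys))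
    ≡⟨ cong₂ _+_ (cong sum (sym (List.map-∘ ys))) (sum-cartesianProduct f xs ys) ⟩
  sum (map (λ y → f (x , y)) ys) + sum (map (λ x → sum (map (λ y → f (x , y)) ys)) xs) ∎
  where open ≡-Reasoning

sum-tabulate-2-periodic : ∀ (f : ℕ → ℕ) → (∀ x → f (2 + x) ≡ f x) →
  ∀ k → sum (tabulate {n = 2 * k} (f ∘ toℕ)) ≡ k * (f 0 + f 1)
sum-tabulate-2-periodic f periodic zero = refl
sum-tabulate-2-periodic f periodic (suc k) =
  subst (λ m → sum (tabulate {n = m} (f ∘ toℕ)) ≡ suc k * (f 0 + f 1)) (sym (*-suc 2 k)) (begin
    f 0 + (f 1 + sum (tabulate {n = 2 * k} (λ i → f (2 + toℕ i))))
      ≡⟨ cong (λ xs → f 0 + (f 1 + sum xs)) (List.tabulate-cong {n = 2 * k} (periodic ∘ toℕ)) ⟩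
    f 0 + (f 1 + sum (tabulate {n = 2 * k} (f ∘ toℕ)))
      ≡⟨ sym (+-assoc (f 0) (f 1) _) ⟩
    (f 0 + f 1) + sum (tabulate {n = 2 * k} (f ∘ toℕ))
      ≡⟨ cong ((f 0 + f 1) +_) (sum-tabulate-2-periodic f periodic k) ⟩
    (f 0 + f 1) + k * (f 0 + f 1) ∎)
  where open ≡-Reasoning

module Transposition {A : Set} (_≟_ : DecidableEquality A) where

  swap : A → A → A → A
  swap a b x with x ≟ a | x ≟ b
  ... | yes _ | _     = b
  ... | no _  | yes _ = a
  ... | no _  | no _  = x

  swap-left : ∀ a b → swap a b a ≡ b
  swap-left a b with a ≟ a
  ... | yes _  = refl
  ... | no a≢a = ⊥-elim (a≢a refl)

  swap-right : ∀ a b → swap a b b ≡ a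
  swap-right a b with b ≟ a | b ≟ b
  ... | yes b≡a | _      = b≡a
  ... | no _    | yes _  = refl
  ... | no _    | no b≢b = ⊥-elim (b≢b refl)

  swap-other : ∀ {a b x} → x ≢ a → x ≢ b → swap a b x ≡ x
  swap-other {a} {b} {x} x≢a x≢b with x ≟ a | x ≟ b
  ... | yes x≡a | _       = ⊥-elim (x≢a x≡a)
  ... | no _    | yes x≡b = ⊥-elim (x≢b x≡b)
  ... | no _    | no _    = refl

  swap-involutive : ∀ a b x → swap a b (swap a b x) ≡ x
  swap-involutive a b x with x ≟ a | x ≟ b
  ... | yes refl | _        = swap-right x b
  ... | no _     | yes refl = swap-left a x
  ... | no x≢a   | no x≢b   = swap-other x≢a x≢b

  swap-injective : ∀ a b {x y} → swap a b x ≡ swap a b y → x ≡ y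
  swap-injective a b {x} {y} eq = begin
    x                       ≡⟨ sym (swap-involutive a b x) ⟩
    swap a b (swap a b x)   ≡⟨ cong (swap a b) eq ⟩
    swap a b (swap a b y)   ≡⟨ swap-involutive a b y ⟩
    y                       ∎
    where open ≡-Reasoning

  swap-preserves : ∀ {B : Set} (f : A → B) {a b} → f a ≡ f b → ∀ x → f (swap a b x) ≡ f x
  swap-preserves f {a} {b} fa≡fb x with x ≟ a | x ≟ b
  ... | yes refl | _        = sym fa≡fb
  ... | no _     | yes refl = fa≡fb
  ... | no _     | no _     = refl

data Kind : Set where
  central even : Kind
  odd : Fin 3 → Kind

kindOf : Bool → Fin 3 → Kind
kindOf true  0F = central
kindOf true  _  = even
kindOf false j  = odd j

nonCentral : Kind → Bool
nonCentral central = false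
nonCentral _       = true

clash : Kind → Kind → Bool
clash even    (odd _) = true
clash (odd _) even    = true
clash (odd j) (odd l) = not (does (j Fin.≟ l))
clash _       _       = false

clash-irreflexive : ∀ k → ¬ T (clash k k)
clash-irreflexive (odd j) c with j Fin.≟ j
... | yes _  = c
... | no j≢j = j≢j refl

clash⇒nonCentralˡ : ∀ k k' → T (clash k k') → T (nonCentral k)
clash⇒nonCentralˡ even    _ _ = _
clash⇒nonCentralˡ (odd _) _ _ = _

clash⇒nonCentralʳ : ∀ k k' → T (clash k k') → T (nonCentral k')
clash⇒nonCentralʳ _ even    _ = _
clash⇒nonCentralʳ _ (odd _) _ = _
clash⇒nonCentralʳ even    central ()
clash⇒nonCentralʳ (odd _) central ()

twistByParity : Bool → Fin 3 → ℕ
twistByParity p j = if p then toℕ j else 3 ∸ toℕ j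

-- The a-components of xy and yx always agree; whether their b-components do depends only on
-- the parities of the a-exponents and on the b-exponents, so it is checked in all 36 cases.
Agreement : Bool → Bool → Fin 3 → Fin 3 → Set
Agreement p q j l = if clash (kindOf p j) (kindOf q l)
  then (twistByParity q j + toℕ l) mod 3 ≢ (twistByParity p l + toℕ j) mod 3
  else (twistByParity q j + toℕ l) mod 3 ≡ (twistByParity p l + toℕ j) mod 3

agreement? : ∀ p q j l → Dec (Agreement p q j l)
agreement? p q j l with clash (kindOf p j) (kindOf q l)
... | true  = ¬? (_ Fin.≟ _)
... | false = _ Fin.≟ _

agreement : ∀ p q j l → Agreement p q j l
agreement true  true  = from-yes (Fin.all? λ j → Fin.all? (agreement? true  true  j))
agreement true  false = from-yes (Fin.all? λ j → Fin.all? (agreement? true  false j))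
agreement false true  = from-yes (Fin.all? λ j → Fin.all? (agreement? false true  j))
agreement false false = from-yes (Fin.all? λ j → Fin.all? (agreement? false false j))

bComponents-agree : ∀ p q j l → ¬ T (clash (kindOf p j) (kindOf q l)) →
                    (twistByParity q j + toℕ l) mod 3 ≡ (twistByParity p l + toℕ j) mod 3
bComponents-agree p q j l ¬c with clash (kindOf p j) (kindOf q l) | agreement p q j l
... | true  | _  = ⊥-elim (¬c _)
... | false | eq = eq

bComponents-differ : ∀ p q j l → T (clash (kindOf p j) (kindOf q l)) →
                     (twistByParity q j + toℕ l) mod 3 ≢ (twistByParity p l + toℕ j) mod 3
bComponents-differ p q j l c with clash (kindOf p j) (kindOf q l) | agreement p q j l
... | true  | neq = neq
... | false | _   = ⊥-elim c

module NonCommutingGraph (n' : ℕ) where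

  n : ℕ
  n = suc n'

  open U n public

  isEven : Fin (2 * n) → Bool
  isEven i = toℕ i % 2 ≡ᵇ 0

  kind : G → Kind
  kind (i , j) = kindOf (isEven i) j

  ·-comm : ∀ x y → ¬ T (clash (kind x) (kind y)) → x · y ≡ y · x
  ·-comm (i , j) (k , l) ¬c = cong₂ _,_
    (cong (_mod (2 * n)) (+-comm (toℕ i) (toℕ k)))
    (bComponents-agree (isEven i) (isEven k) j l ¬c)

  ·-noncomm : ∀ x y → T (clash (kind x) (kind y)) → x · y ≢ y · x
  ·-noncomm (i , j) (k , l) c = bComponents-differ (isEven i) (isEven k) j l c ∘ cong proj₂

  ¬nonCentral⇒Central : ∀ x → ¬ T (nonCentral (kind x)) → Central x
  ¬nonCentral⇒Central x ¬nc g = ·-comm x g (¬nc ∘ clash⇒nonCentralˡ (kind x) (kind g))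

  Vertex⇒nonCentral : ∀ {x} → Vertex x → T (nonCentral (kind x))
  Vertex⇒nonCentral {x} vx = decidable-stable (T? _) (vx ∘ ¬nonCentral⇒Central x)

  oddBit : Bool → ℕ
  oddBit true  = 0
  oddBit false = 1

  exponent< : ∀ p (m : Fin n) → oddBit p + toℕ m * 2 < 2 * n
  exponent< p m = begin-strict
    oddBit p + toℕ m * 2 ≤⟨ +-monoˡ-≤ (toℕ m * 2) (oddBit≤1 p) ⟩
    1 + toℕ m * 2        <⟨ n<1+n _ ⟩
    suc (toℕ m) * 2      ≤⟨ *-monoˡ-≤ 2 (Fin.toℕ<n m) ⟩
    n * 2                ≡⟨ *-comm n 2 ⟩
    2 * n                ∎
    where
    open ≤-Reasoning
    oddBit≤1 : ∀ p → oddBit p ≤ 1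
    oddBit≤1 true  = z≤n
    oddBit≤1 false = s≤s z≤n

  exponent : Bool → Fin n → Fin (2 * n)
  exponent p m = fromℕ< (exponent< p m)

  toℕ-exponent : ∀ p m → toℕ (exponent p m) ≡ oddBit p + toℕ m * 2
  toℕ-exponent p m = Fin.toℕ-fromℕ< (exponent< p m)

  isEven-exponent : ∀ p m → isEven (exponent p m) ≡ p
  isEven-exponent p m = begin
    toℕ (exponent p m) % 2 ≡ᵇ 0      ≡⟨ cong (λ k → k % 2 ≡ᵇ 0) (toℕ-exponent p m) ⟩
    (oddBit p + toℕ m * 2) % 2 ≡ᵇ 0  ≡⟨ cong (_≡ᵇ 0) ([m+kn]%n≡m%n (oddBit p) (toℕ m) 2) ⟩
    oddBit p % 2 ≡ᵇ 0                ≡⟨ parity-oddBit p ⟩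
    p                                ∎
    where
    open ≡-Reasoning
    parity-oddBit : ∀ p → (oddBit p % 2 ≡ᵇ 0) ≡ p
    parity-oddBit true  = refl
    parity-oddBit false = refl

  exponent-injective : ∀ {p q m m'} → exponent p m ≡ exponent q m' → p ≡ q × m ≡ m'
  exponent-injective {p} {q} {m} {m'} eq
    with trans (sym (isEven-exponent p m)) (trans (cong isEven eq) (isEven-exponent q m'))
  ... | refl = refl , Fin.toℕ-injective (*-cancelʳ-≡ (toℕ m) (toℕ m') 2 (+-cancelˡ-≡ (oddBit p) _ _
                (trans (sym (toℕ-exponent p m)) (trans (cong toℕ eq) (toℕ-exponent p m')))))

  Code : Set
  Code = Fin n × Bool × Fin 3

  evenᶜ oddᶜ : Fin n → Fin 3 → Code
  evenᶜ m j = m , true , j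
  oddᶜ  m j = m , false , j

  ⟦_⟧ : Code → G
  ⟦ m , p , j ⟧ = exponent p m , j

  ⟦⟧-injective : ∀ {c c'} → ⟦ c ⟧ ≡ ⟦ c' ⟧ → c ≡ c'
  ⟦⟧-injective {m , p , j} {m' , p' , j'} eq
    with exponent-injective {p} {p'} {m} {m'} (cong proj₁ eq) | cong proj₂ eq
  ... | refl , refl | refl = refl

  shape : Code → Kind
  shape (_ , p , j) = kindOf p j

  kind-⟦⟧ : ∀ c → kind ⟦ c ⟧ ≡ shape c
  kind-⟦⟧ (m , p , j) = cong (λ q → kindOf q j) (isEven-exponent p m)

  _≟ᶜ_ : DecidableEquality Code
  _≟ᶜ_ = ≡-dec Fin._≟_ (≡-dec Bool._≟_ Fin._≟_)

  open DecUnique _≟ᶜ_ using (unique?)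
  open DecMembership (Fin._≟_ {n}) using (_∈?_)

  nonCentral⇒Vertex : ∀ {x} → T (nonCentral (kind x)) → Vertex x
  nonCentral⇒Vertex {x} nc x-central =
    ·-noncomm x ⟦ witness (kind x) ⟧ clashes (x-central ⟦ witness (kind x) ⟧)
    where
    witness : Kind → Code
    witness (odd _) = evenᶜ 0F 1F
    witness _       = oddᶜ 0F 0F
    witness-clashes : ∀ k → T (nonCentral k) → T (clash k (shape (witness k)))
    witness-clashes even    _ = _
    witness-clashes (odd _) _ = _
    clashes : T (clash (kind x) (kind ⟦ witness (kind x) ⟧))
    clashes = subst (T ∘ clash (kind x)) (sym (kind-⟦⟧ (witness (kind x)))) (witness-clashes (kind x) nc)

  Vertex-resp-kind : ∀ {x y} → kind x ≡ kind y → Vertex x → Vertex y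
  Vertex-resp-kind eq = nonCentral⇒Vertex ∘ subst (T ∘ nonCentral) eq ∘ Vertex⇒nonCentral

  clash⇒Adj : ∀ x y → T (clash (kind x) (kind y)) → Adj x y
  clash⇒Adj x y c =
      nonCentral⇒Vertex (clash⇒nonCentralˡ (kind x) (kind y) c)
    , nonCentral⇒Vertex (clash⇒nonCentralʳ (kind x) (kind y) c)
    , (λ { refl → clash-irreflexive (kind x) c })
    , ·-noncomm x y c

  Adj⇒clash : ∀ {x y} → Adj x y → T (clash (kind x) (kind y))
  Adj⇒clash {x} {y} (_ , _ , _ , x·y≢y·x) = decidable-stable (T? _) (x·y≢y·x ∘ ·-comm x y)

  Adj-resp-kind : ∀ {x x' y y'} → kind x ≡ kind x' → kind y ≡ kind y' → Adj x y → Adj x' y'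
  Adj-resp-kind {x' = x'} {y' = y'} eqx eqy =
    clash⇒Adj x' y' ∘ subst₂ (λ k k' → T (clash k k')) eqx eqy ∘ Adj⇒clash

  Walk-map : ∀ (σ : G → G) → (∀ x → kind (σ x) ≡ kind x) →
             ∀ {u ps v} → Walk u ps v → Walk (σ u) (map σ ps) (σ v)
  Walk-map σ σ-kind (stop vu)    = stop (Vertex-resp-kind (sym (σ-kind _)) vu)
  Walk-map σ σ-kind (step uw wv) =
    step (Adj-resp-kind (sym (σ-kind _)) (sym (σ-kind _)) uw) (Walk-map σ σ-kind wv)

  Walk-vertices : ∀ {u ps v} → Walk u ps v → All Vertex ps
  Walk-vertices (stop vu)    = vu ∷ []
  Walk-vertices (step uw wv) = proj₁ uw ∷ Walk-vertices wv

  Walk-end∈ : ∀ {u ps v} → Walk u ps v → v ∈ ps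
  Walk-end∈ (stop _)    = here refl
  Walk-end∈ (step _ wv) = there (Walk-end∈ wv)

  SimplePath-ends-distinct : ∀ {u ps v} → SimplePath u ps v → 1 < length ps → u ≢ v
  SimplePath-ends-distinct (stop _ , _)         (s≤s ())
  SimplePath-ends-distinct (step _ wv , u∉ ∷ _) _ refl = All.lookup u∉ (Walk-end∈ wv) refl

  adjacent : ∀ c c' → T (clash (shape c) (shape c')) → Adj ⟦ c ⟧ ⟦ c' ⟧
  adjacent c c' = clash⇒Adj ⟦ c ⟧ ⟦ c' ⟧ ∘ subst₂ (λ k k' → T (clash k k')) (sym (kind-⟦⟧ c)) (sym (kind-⟦⟧ c'))

  Linked : Kind → List Kind → Set
  Linked k []        = T (nonCentral k)
  Linked k (k' ∷ ks) = T (clash k k') × Linked k' ks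

  lastOf : Code → List Code → Code
  lastOf c []        = c
  lastOf _ (c ∷ cs) = lastOf c cs

  Walk-linked : ∀ c cs → Linked (shape c) (map shape cs) → Walk ⟦ c ⟧ (map ⟦_⟧ (c ∷ cs)) ⟦ lastOf c cs ⟧
  Walk-linked c []        nc       = stop (nonCentral⇒Vertex (subst (T ∘ nonCentral) (sym (kind-⟦⟧ c)) nc))
  Walk-linked c (c' ∷ cs) (cc' , ok) = step (adjacent c c' cc') (Walk-linked c' cs ok)

  -- A block visits a^(2m) b, a^(2m+1), a^(2m) b², a^(2m+1) b, a^(2m+1) b² in this order;
  -- it can be entered from any vertex clashing with an even one and left towards any even vertex.
  blockPattern : List (Bool × Fin 3)
  blockPattern = (true , 1F) ∷ (false , 0F) ∷ (true , 2F) ∷ (false , 1F) ∷ (false , 2F) ∷ []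

  blocks : List (Fin n) → List Code
  blocks ms = cartesianProduct ms blockPattern

  length-blocks : ∀ ms → length (blocks ms) ≡ 5 * length ms
  length-blocks []       = refl
  length-blocks (m ∷ ms) = trans (cong (5 +_) (length-blocks ms)) (sym (*-suc 5 (length ms)))

  Walk-blocks : ∀ ms c a post {v} → T (clash (shape c) even) → shape a ≡ even →
                Walk ⟦ a ⟧ (map ⟦_⟧ (a ∷ post)) v → Walk ⟦ c ⟧ (map ⟦_⟧ (c ∷ blocks ms ++ a ∷ post)) v
  Walk-blocks []       c a post ce a-even w =
    step (adjacent c a (subst (T ∘ clash (shape c)) (sym a-even) ce)) w
  Walk-blocks (m ∷ ms) c a post ce a-even w =
    step (adjacent c (evenᶜ m 1F) ce)
    (step (adjacent (evenᶜ m 1F) (oddᶜ m 0F) _)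
    (step (adjacent (oddᶜ m 0F) (evenᶜ m 2F) _)
    (step (adjacent (evenᶜ m 2F) (oddᶜ m 1F) _)
    (step (adjacent (oddᶜ m 1F) (oddᶜ m 2F) _)
    (Walk-blocks ms (oddᶜ m 2F) a post _ a-even w)))))

  Walk-spliced : ∀ ms c pre a post → shape a ≡ even → Linked (shape c) (map shape (pre ++ a ∷ post)) →
                 Walk ⟦ c ⟧ (map ⟦_⟧ (c ∷ pre ++ blocks ms ++ a ∷ post)) ⟦ lastOf a post ⟧
  Walk-spliced ms c []         a post a-even (ca , ok) =
    Walk-blocks ms c a post (subst (T ∘ clash (shape c)) a-even ca) a-even (Walk-linked a post ok)
  Walk-spliced ms c (c' ∷ pre) a post a-even (cc' , ok) =
    step (adjacent c c' cc') (Walk-spliced ms c' pre a post a-even ok)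

  Unique-spliced : ∀ ms pre post → Unique ms → Unique (pre ++ post) →
                   All (λ c → proj₁ c ∉ ms) (pre ++ post) → Unique (pre ++ blocks ms ++ post)
  Unique-spliced ms pre post !ms !F avoid = Unique-insert pre !F
    (Unique.cartesianProduct⁺ !ms (from-yes (DecUnique.unique? (≡-dec Bool._≟_ Fin._≟_) blockPattern)))
    (λ (c∈blocks , c∈F) → All.lookup avoid c∈F (proj₁ (∈-cartesianProduct⁻ ms blockPattern c∈blocks)))

  record HamiltonianPath (k k' : Kind) : Set where
    field
      start end   : G
      path        : List G
      simple      : SimplePath start path end
      length-path : length path ≡ 5 * n
      kind-start  : kind start ≡ k
      kind-end    : kind end ≡ k'

  splicedPath : ∀ ms c pre a post → shape a ≡ even → Linked (shape c) (map shape (pre ++ a ∷ post)) →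
    Unique ms → Unique (c ∷ pre ++ a ∷ post) → All (λ c → proj₁ c ∉ ms) (c ∷ pre ++ a ∷ post) →
    5 * length ms + length (c ∷ pre ++ a ∷ post) ≡ 5 * n →
    HamiltonianPath (shape c) (shape (lastOf a post))
  splicedPath ms c pre a post a-even linked !ms !F avoid total = record
    { start       = ⟦ c ⟧
    ; end         = ⟦ lastOf a post ⟧
    ; path        = map ⟦_⟧ (c ∷ pre ++ blocks ms ++ a ∷ post)
    ; simple      = Walk-spliced ms c pre a post a-even linked
                  , Unique.map⁺ ⟦⟧-injective (Unique-spliced ms (c ∷ pre) (a ∷ post) !ms !F avoid)
    ; length-path = begin
        length (map ⟦_⟧ (c ∷ pre ++ blocks ms ++ a ∷ post))
          ≡⟨ List.length-map ⟦_⟧ (c ∷ pre ++ blocks ms ++ a ∷ post) ⟩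
        length ((c ∷ pre) ++ blocks ms ++ a ∷ post)
          ≡⟨ length-insert (c ∷ pre) (blocks ms) (a ∷ post) ⟩
        length (blocks ms) + length (c ∷ pre ++ a ∷ post)
          ≡⟨ cong (_+ _) (length-blocks ms) ⟩
        5 * length ms + length (c ∷ pre ++ a ∷ post)
          ≡⟨ total ⟩
        5 * n ∎
    ; kind-start  = kind-⟦⟧ c
    ; kind-end    = kind-⟦⟧ (lastOf a post)
    }
    where open ≡-Reasoning

  -- The explicit vertices c ∷ pre ++ a ∷ post lie in the first k blocks; all other blocks are
  -- spliced in just before a = a^(2m) b².
  splicedPathFrom : ∀ k c pre m post → let a = evenᶜ m 2F ; F = c ∷ pre ++ a ∷ post in
    {Linked (shape c) (map shape (pre ++ a ∷ post))} →
    {True (unique? F)} →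
    {True (All.all? (_∈? take k (allFin n)) (map proj₁ F))} →
    {True (length F ≟ 5 * k)} →
    {True (k ≤? n)} →
    HamiltonianPath (shape c) (shape (lastOf a post))
  splicedPathFrom k c pre m post {linked} {uniqueF} {inFront} {lengthF} {k≤n} =
    splicedPath (drop k (allFin n)) c pre (evenᶜ m 2F) post refl linked
      (Unique.drop⁺ k (Unique.allFin⁺ n)) (toWitness {a? = unique? F} uniqueF)
      (All.map inFront⇒∉rest (All.map⁻ (toWitness {a? = All.all? (_∈? take k (allFin n)) (map proj₁ F)} inFront)))
      total
    where
    F = c ∷ pre ++ evenᶜ m 2F ∷ post
    inFront⇒∉rest : ∀ {i} → i ∈ take k (allFin n) → i ∉ drop k (allFin n)
    inFront⇒∉rest i∈ i∉ = Unique-++⇒Disjoint (take k (allFin n))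
      (subst Unique (sym (List.take++drop≡id k (allFin n))) (Unique.allFin⁺ n)) (i∈ , i∉)
    total : 5 * length (drop k (allFin n)) + length F ≡ 5 * n
    total = begin
      5 * length (drop k (allFin n)) + length F
        ≡⟨ cong₂ (λ r f → 5 * r + f) (List.length-drop k (allFin n)) (toWitness {a? = length F ≟ 5 * k} lengthF) ⟩
      5 * (length (allFin n) ∸ k) + 5 * k
        ≡⟨ sym (*-distribˡ-+ 5 (length (allFin n) ∸ k) k) ⟩
      5 * (length (allFin n) ∸ k + k)
        ≡⟨ cong (5 *_) (m∸n+n≡m (subst (k ≤_) (sym (length-allFin n)) (toWitness {a? = k ≤? n} k≤n))) ⟩
      5 * length (allFin n)
        ≡⟨ cong (5 *_) (length-allFin n) ⟩
      5 * n ∎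
      where open ≡-Reasoning

  open Transposition _≟G_

  transport : ∀ {u v} → HamiltonianPath (kind u) (kind v) → u ≢ v →
              Σ (List G) λ ps → SimplePath u ps v × length ps ≡ 5 * n
  transport {u} {v} P u≢v =
      map σ path
    , (subst₂ (λ x y → Walk x (map σ path) y) σ-start σ-end (Walk-map σ σ-kind (proj₁ simple))
      , Unique.map⁺ σ-injective (proj₂ simple))
    , trans (List.length-map σ path) length-path
    where
    open HamiltonianPath P
    start≢end : start ≢ end
    start≢end = SimplePath-ends-distinct simple
      (subst (1 <_) (sym length-path) (≤-trans (s≤s (s≤s z≤n)) (*-monoʳ-≤ 5 (s≤s z≤n))))
    end′ : G
    end′ = swap start u end
    σ : G → G
    σ = swap end′ v ∘ swap start u
    u≢end′ : u ≢ end′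
    u≢end′ eq = start≢end (swap-injective start u (trans (swap-left start u) eq))
    σ-start : σ start ≡ u
    σ-start = trans (cong (swap end′ v) (swap-left start u)) (swap-other u≢end′ u≢v)
    σ-end : σ end ≡ v
    σ-end = swap-left end′ v
    σ-kind : ∀ x → kind (σ x) ≡ kind x
    σ-kind x = trans (swap-preserves kind (trans (swap-preserves kind kind-start end) kind-end) (swap start u x))
                     (swap-preserves kind kind-start x)
    σ-injective : ∀ {x y} → σ x ≡ σ y → x ≡ y
    σ-injective = swap-injective start u ∘ swap-injective end′ v

  evenPath : HamiltonianPath even even
  evenPath = splicedPathFrom 1 (evenᶜ 0F 1F) (oddᶜ 0F 0F ∷ oddᶜ 0F 1F ∷ oddᶜ 0F 2F ∷ []) 0F []

  clashPath : ∀ k k' → T (clash k k') → HamiltonianPath k k'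
  clashPath even     (odd 0F) _ = splicedPathFrom 1 (evenᶜ 0F 1F) (oddᶜ 0F 1F ∷ []) 0F (oddᶜ 0F 2F ∷ oddᶜ 0F 0F ∷ [])
  clashPath even     (odd 1F) _ = splicedPathFrom 1 (evenᶜ 0F 1F) (oddᶜ 0F 0F ∷ []) 0F (oddᶜ 0F 2F ∷ oddᶜ 0F 1F ∷ [])
  clashPath even     (odd 2F) _ = splicedPathFrom 1 (evenᶜ 0F 1F) (oddᶜ 0F 0F ∷ []) 0F (oddᶜ 0F 1F ∷ oddᶜ 0F 2F ∷ [])
  clashPath (odd 0F) even     _ = splicedPathFrom 1 (oddᶜ 0F 0F) (evenᶜ 0F 1F ∷ oddᶜ 0F 1F ∷ oddᶜ 0F 2F ∷ []) 0F []
  clashPath (odd 1F) even     _ = splicedPathFrom 1 (oddᶜ 0F 1F) (evenᶜ 0F 1F ∷ oddᶜ 0F 0F ∷ oddᶜ 0F 2F ∷ []) 0F []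
  clashPath (odd 2F) even     _ = splicedPathFrom 1 (oddᶜ 0F 2F) (evenᶜ 0F 1F ∷ oddᶜ 0F 0F ∷ oddᶜ 0F 1F ∷ []) 0F []
  clashPath (odd 0F) (odd 1F) _ = splicedPathFrom 1 (oddᶜ 0F 0F) (evenᶜ 0F 1F ∷ oddᶜ 0F 2F ∷ []) 0F (oddᶜ 0F 1F ∷ [])
  clashPath (odd 0F) (odd 2F) _ = splicedPathFrom 1 (oddᶜ 0F 0F) (evenᶜ 0F 1F ∷ oddᶜ 0F 1F ∷ []) 0F (oddᶜ 0F 2F ∷ [])
  clashPath (odd 1F) (odd 0F) _ = splicedPathFrom 1 (oddᶜ 0F 1F) (evenᶜ 0F 1F ∷ oddᶜ 0F 2F ∷ []) 0F (oddᶜ 0F 0F ∷ [])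
  clashPath (odd 1F) (odd 2F) _ = splicedPathFrom 1 (oddᶜ 0F 1F) (evenᶜ 0F 1F ∷ oddᶜ 0F 0F ∷ []) 0F (oddᶜ 0F 2F ∷ [])
  clashPath (odd 2F) (odd 0F) _ = splicedPathFrom 1 (oddᶜ 0F 2F) (evenᶜ 0F 1F ∷ oddᶜ 0F 1F ∷ []) 0F (oddᶜ 0F 0F ∷ [])
  clashPath (odd 2F) (odd 1F) _ = splicedPathFrom 1 (oddᶜ 0F 2F) (evenᶜ 0F 1F ∷ oddᶜ 0F 0F ∷ []) 0F (oddᶜ 0F 1F ∷ [])
  clashPath central  _        ()
  clashPath even     central  ()
  clashPath even     even     ()
  clashPath (odd _)  central  ()
  clashPath (odd 0F) (odd 0F) ()
  clashPath (odd 1F) (odd 1F) ()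
  clashPath (odd 2F) (odd 2F) ()

  ∈-vertices : ∀ {x} → Vertex x → x ∈ vertices
  ∈-vertices {i , j} vx = ∈-filter⁺ (λ x → ¬? (central? x)) (∈-cartesianProduct⁺ (∈-allFin i) (∈-allFin j)) vx

  vertices-unique : Unique vertices
  vertices-unique = Unique.filter⁺ (λ x → ¬? (central? x))
    (Unique.cartesianProduct⁺ (Unique.allFin⁺ (2 * n)) (Unique.allFin⁺ 3))

  isVertex≡nonCentral : ∀ x → does (¬? (central? x)) ≡ nonCentral (kind x)
  isVertex≡nonCentral x with nonCentral (kind x) in eq
  ... | true  = dec-true (¬? (central? x)) (nonCentral⇒Vertex (subst T (sym eq) _))
  ... | false = dec-false (¬? (central? x)) (subst T eq ∘ Vertex⇒nonCentral)

  nonCentralCount : Bool → ℕ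
  nonCentralCount p = sum (map (λ j → if nonCentral (kindOf p j) then 1 else 0) (allFin 3))

  length-vertices : length vertices ≡ 5 * n
  length-vertices = begin
    length vertices
      ≡⟨ length-filter≡sum (λ x → ¬? (central? x)) elements ⟩
    sum (map (λ x → if does (¬? (central? x)) then 1 else 0) elements)
      ≡⟨ cong sum (List.map-cong (cong (λ b → if b then 1 else 0) ∘ isVertex≡nonCentral) elements) ⟩
    sum (map (λ x → if nonCentral (kind x) then 1 else 0) elements)
      ≡⟨ sum-cartesianProduct (λ x → if nonCentral (kind x) then 1 else 0) (allFin (2 * n)) (allFin 3) ⟩
    sum (map (nonCentralCount ∘ isEven) (allFin (2 * n)))
      ≡⟨ cong sum (List.map-tabulate id (nonCentralCount ∘ isEven)) ⟩
    sum (tabulate {n = 2 * n} (λ i → nonCentralCount (toℕ i % 2 ≡ᵇ 0)))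
      ≡⟨ sum-tabulate-2-periodic (λ k → nonCentralCount (k % 2 ≡ᵇ 0)) (λ _ → refl) n ⟩
    n * 5
      ≡⟨ *-comm n 5 ⟩
    5 * n ∎
    where open ≡-Reasoning

  SimplePath-length≤ : ∀ {u ps v} → SimplePath u ps v → length ps ≤ 5 * n
  SimplePath-length≤ {ps = ps} (walk , unique) = subst (length ps ≤_) length-vertices
    (Unique-⊆⇒length≤ unique (∈-vertices ∘ All.lookup (Walk-vertices walk)))

  detourDistance : ∀ {u v} → HamiltonianPath (kind u) (kind v) → u ≢ v → IsDetourDistance u v (5 * n ∸ 1)
  detourDistance P u≢v = transport P u≢v , λ _ → SimplePath-length≤

  orderedDetourSum-constant : orderedDetourSum (λ _ _ → 5 * n ∸ 1) ≡ 5 * n * (5 * n ∸ 1) ^ 2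
  orderedDetourSum-constant = begin
    orderedDetourSum (λ _ _ → d)                   ≡⟨ sumOverDistinctPairs _≟G_ d vertices-unique ⟩
    length vertices * ((length vertices ∸ 1) * d)  ≡⟨ cong (λ L → L * ((L ∸ 1) * d)) length-vertices ⟩
    5 * n * (d * d)                                ≡⟨ cong (λ x → 5 * n * (d * x)) (sym (*-identityʳ d)) ⟩
    5 * n * d ^ 2                                  ∎
    where
    open ≡-Reasoning
    d = 5 * n ∸ 1

module _ (n'' : ℕ) where
  open NonCommutingGraph (suc n'')

  sameOddPath : ∀ j → HamiltonianPath (odd j) (odd j)
  sameOddPath 0F = splicedPathFrom 2 (oddᶜ 0F 0F) (evenᶜ 0F 1F ∷ oddᶜ 0F 1F ∷ evenᶜ 0F 2F ∷ oddᶜ 0F 2F ∷ [])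
                     1F (oddᶜ 1F 1F ∷ evenᶜ 1F 1F ∷ oddᶜ 1F 2F ∷ oddᶜ 1F 0F ∷ [])
  sameOddPath 1F = splicedPathFrom 2 (oddᶜ 0F 1F) (evenᶜ 0F 1F ∷ oddᶜ 0F 0F ∷ evenᶜ 0F 2F ∷ oddᶜ 0F 2F ∷ [])
                     1F (oddᶜ 1F 0F ∷ evenᶜ 1F 1F ∷ oddᶜ 1F 2F ∷ oddᶜ 1F 1F ∷ [])
  sameOddPath 2F = splicedPathFrom 2 (oddᶜ 0F 2F) (evenᶜ 0F 1F ∷ oddᶜ 0F 0F ∷ evenᶜ 0F 2F ∷ oddᶜ 0F 1F ∷ [])
                     1F (oddᶜ 1F 0F ∷ evenᶜ 1F 1F ∷ oddᶜ 1F 1F ∷ oddᶜ 1F 2F ∷ [])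

oddKind-unique : ∀ {u v : NonCommutingGraph.G 0} {j} →
                 NonCommutingGraph.kind 0 u ≡ odd j → NonCommutingGraph.kind 0 v ≡ odd j → u ≡ v
oddKind-unique {1F , _} {1F , _} refl refl = refl
oddKind-unique {0F , 0F}    ()
oddKind-unique {0F , Fin.suc _} ()
oddKind-unique {1F , _} {0F , 0F}    _ ()
oddKind-unique {1F , _} {0F , Fin.suc _} _ ()

sameOddKindPath : ∀ n' j {u v : NonCommutingGraph.G n'} → u ≢ v →
                  NonCommutingGraph.kind n' u ≡ odd j → NonCommutingGraph.kind n' v ≡ odd j →
                  NonCommutingGraph.HamiltonianPath n' (odd j) (odd j)
sameOddKindPath zero      j u≢v ku kv = ⊥-elim (u≢v (oddKind-unique ku kv))
sameOddKindPath (suc n'') j _   _  _  = sameOddPath n'' j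

module _ (n' : ℕ) where
  open NonCommutingGraph n'

  pathBetween : ∀ {u v} → Vertex u → Vertex v → u ≢ v → HamiltonianPath (kind u) (kind v)
  pathBetween {u} {v} vu vv u≢v with kind u in ku | kind v in kv
  ... | central | _       = ⊥-elim (subst (T ∘ nonCentral) ku (Vertex⇒nonCentral vu))
  ... | _       | central = ⊥-elim (subst (T ∘ nonCentral) kv (Vertex⇒nonCentral vv))
  ... | even    | even    = evenPath
  ... | even    | odd l   = clashPath even (odd l) _
  ... | odd j   | even    = clashPath (odd j) even _
  ... | odd j   | odd l with j Fin.≟ l
  ...   | yes refl = sameOddKindPath n' j u≢v ku kv
  ...   | no j≢l   = clashPath (odd j) (odd l) (subst (T ∘ not) (sym (dec-false (j Fin.≟ l) j≢l)) _)

corollary4p3 : (n : ℕ) → .{{_ : NonZero n}} →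
    Σ (U.G n → U.G n → ℕ) (λ D →
      ((u v : U.G n) → U.Vertex n u → U.Vertex n v → u ≢ v → U.IsDetourDistance n u v (D u v))
      × (U.orderedDetourSum n D ≡ 5 * n * (5 * n ∸ 1) ^ 2))
corollary4p3 (suc n') =
    (λ _ _ → 5 * n ∸ 1)
  , (λ u v vu vv u≢v → detourDistance (pathBetween n' vu vv u≢v) u≢v)
  , orderedDetourSum-constant
  where open NonCommutingGraph n'
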